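{- Let $m$ be an integer and $n$ a positive integer. Let $Q_{m,n}$ be the set of doubly marked partitions of $n$ with spt-crank $m$, and let $P_n$ be the set of pairs of partitions $(\alpha,\beta)$ with $|\alpha|+|\beta|=n$ such that all parts of $\beta$ are equal. For $(\lambda,s,t)\in Q_{m,n}$ with $\lambda=(\lambda_1,\dots,\lambda_\ell)$, define $\psi(\lambda,s,t)=(\alpha,\beta)$ by $$\alpha=(\lambda_1-t+s-1,\ \dots,\ \lambda_{\lambda'_s}-t+s-1,\ \lambda_{\lambda'_s+1},\ \dots,\ \lambda_\ell),\qquad \beta=(\lambda'_s,\lambda'_{s+1},\dots,\lambda'_t).$$ Then $\psi$ is an injective map from $Q_{m,n}$ into $P_n$.
   Context: Partitions are written with weakly decreasing parts; $\lambda'$ is the conjugate of $\lambda$ (so $\lambda'_s$ is the number of parts of $\lambda$ that are $\ge s$), and $D(\lambda)$ is the side length of the Durfee square of $\lambda$. A doubly marked partition of $n$ is a triple $(\lambda,s,t)$ where $\lambda$ is a partition of $n$ and $s,t$ are integers with $1\le s\le D(\lambda)$, $s\le t\le\lambda_1$, and $\lambda'_s=\lambda'_t$. With $g=\lambda'_s-s+1$, its spt-crank is $c(\lambda,s,t)=g-\lambda_g+t-s$. -}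

module Defs where

open import Data.Nat using (ℕ; zero; suc; _+_; _∸_; _≤_; _<_; _≤?_)
open import Data.Integer as ℤ using (ℤ; +_)
open import Data.Nat.ListAction using (sum)
open import Data.List using (List; []; _∷_; map; take; drop; _++_; upTo)
open import Data.List.Relation.Unary.All using (All)
open import Data.List.Relation.Unary.Linked using (Linked)
open import Data.List.Membership.Propositional using (_∈_)
open import Data.Product using (_×_; _,_)
open import Relation.Binary.PropositionalEquality using (_≡_)
open import Relation.Nullary using (yes; no)

record IsPartition (p : List ℕ) : Set where
  field
    decreasing : Linked (λ a b → b ≤ a) p
    positive   : All (λ a → 0 < a) p

-- λ_i, 1-based; 0 if i exceeds the length (and for i = 0, unused)
part : List ℕ → ℕ → ℕ
part []       _             = 0
part (x ∷ xs) zero          = 0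
part (x ∷ xs) (suc zero)    = x
part (x ∷ xs) (suc (suc i)) = part xs (suc i)

conj : List ℕ → ℕ → ℕ
conj []       s = 0
conj (x ∷ xs) s with s ≤? x
... | yes _ = suc (conj xs s)
... | no  _ = conj xs s

-- Durfee square side: largest d with λ_1 ≥ 1, ..., λ_d ≥ d
-- (for a partition: the largest d with λ_d ≥ d)
durfeeFrom : ℕ → List ℕ → ℕ
durfeeFrom i []       = 0
durfeeFrom i (x ∷ xs) with i ≤? x
... | yes _ = suc (durfeeFrom (suc i) xs)
... | no  _ = 0

durfee : List ℕ → ℕ
durfee = durfeeFrom 1

record IsDMP (n : ℕ) (l : List ℕ) (s t : ℕ) : Set where
  field
    isPart  : IsPartition l
    size    : sum l ≡ n
    s-pos   : 1 ≤ s
    s≤D     : s ≤ durfee l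
    s≤t     : s ≤ t
    t≤λ₁    : t ≤ part l 1
    conj-eq : conj l s ≡ conj l t

-- spt-crank: g = λ'_s - s + 1 (a positive integer, as s ≤ D(λ) ≤ λ'_s),
-- c = g - λ_g + t - s
sptCrank : List ℕ → ℕ → ℕ → ℤ
sptCrank l s t = ((+ g ℤ.- + part l g) ℤ.+ + t) ℤ.- + s
  where g = conj l s ∸ s + 1

InQ : ℤ → ℕ → List ℕ → ℕ → ℕ → Set
InQ m n l s t = IsDMP n l s t × sptCrank l s t ≡ m

AllEqual : List ℕ → Set
AllEqual b = ∀ {x y} → x ∈ b → y ∈ b → x ≡ y

InP : ℕ → List ℕ × List ℕ → Set
InP n (a , b) = IsPartition a × IsPartition b × (sum a + sum b ≡ n) × AllEqual b

dropZeros : List ℕ → List ℕ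
dropZeros []             = []
dropZeros (zero  ∷ xs)   = dropZeros xs
dropZeros (suc x ∷ xs)   = suc x ∷ dropZeros xs

ψ : List ℕ → ℕ → ℕ → List ℕ × List ℕ
ψ l s t = α , β
  where
    k = conj l s
    α = dropZeros (map (λ x → (x + s) ∸ (t + 1)) (take k l) ++ drop k l)
    β = map (λ j → conj l (s + j)) (upTo (suc (t ∸ s)))

-- Let (λ, s, t) be doubly marked and write k = λ'_s = λ'_t, L = t - s + 1.
-- Because λ'_s = λ'_t, the first k parts of λ are ≥ t and the others are < s.
-- Hence β = (k, …, k) (L copies), and α is λ with its first k parts lowered
-- by L (then zeros removed).  Lowering keeps the list weakly decreasing, since
-- a lowered part is ≥ t - L = s - 1 while an untouched part is ≤ s - 1; and it
-- removes exactly k·L cells, so |α| + |β| = |λ| = n.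
--
-- For injectivity, β determines k and L, and α determines the lowered list
-- M.  With j₀ = k - s (0-based), the spt-crank equals j₀ - M_{j₀}; as
-- j ↦ j - M_j is strictly increasing, the crank determines j₀, hence s = k - j₀
-- and t = s + L - 1, and finally λ is recovered from M by raising its first k
-- entries by L.
module Submission where

open import Defs
open import Data.Nat using (ℕ; zero; suc; _+_; _*_; _∸_; _≤_; _<_; _≤?_; _<?_; z≤n; s≤s; _≤′_; ≤′-refl; ≤′-step)
open import Data.Nat.Properties
open import Algebra.Properties.CommutativeSemigroup +-commutativeSemigroup using (interchange)
open import Data.Integer as ℤ using (ℤ; _⊖_)
import Data.Integer.Properties as ℤP
open import Data.Integer.Tactic.RingSolver using (solve-∀)
open import Data.Nat.ListAction using (sum)
open import Data.List using (List; []; _∷_; map; take; drop; _++_; applyUpTo; replicate; length)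
open import Data.List.Properties using (map-cong; map-upTo; length-replicate; ∷-injectiveˡ)
open import Data.List.Relation.Unary.All as All using (All; []; _∷_)
open import Data.List.Relation.Unary.All.Properties using (replicate⁺)
open import Data.List.Relation.Unary.Linked using (Linked; []; [-]; _∷_)
open import Data.Product using (_×_; _,_; proj₁; proj₂)
open import Data.Empty using (⊥-elim)
open import Relation.Nullary using (yes; no)
open import Relation.Binary using (tri<; tri≈; tri>)
open import Relation.Binary.PropositionalEquality

get : List ℕ → ℕ → ℕ
get []       _       = 0
get (x ∷ xs) zero    = x
get (x ∷ xs) (suc j) = get xs j

part-get : ∀ xs j → part xs (suc j) ≡ get xs j
part-get []       j       = refl
part-get (x ∷ xs) zero    = refl
part-get (x ∷ xs) (suc j) = part-get xs j

positive-ext : ∀ {xs ys} → All (0 <_) xs → All (0 <_) ys →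
               (∀ j → get xs j ≡ get ys j) → xs ≡ ys
positive-ext []       []       _ = refl
positive-ext []       (q ∷ _)  e = ⊥-elim (<-irrefl (e 0) q)
positive-ext (p ∷ _)  []       e = ⊥-elim (<-irrefl (sym (e 0)) p)
positive-ext (_ ∷ ps) (_ ∷ qs) e = cong₂ _∷_ (e 0) (positive-ext ps qs (λ j → e (suc j)))

-- Weakly decreasing lists, in the form used by `IsPartition`, and the
-- equivalent entrywise form, which is easier to establish for padded lists.
Decreasing : List ℕ → Set
Decreasing = Linked (λ a b → b ≤ a)

StepDown : List ℕ → Set
StepDown xs = ∀ j → get xs (suc j) ≤ get xs j

decreasing⇒stepDown : ∀ {xs} → Decreasing xs → StepDown xs
decreasing⇒stepDown []      j       = z≤n
decreasing⇒stepDown [-]     j       = z≤n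
decreasing⇒stepDown (r ∷ _) zero    = r
decreasing⇒stepDown (_ ∷ d) (suc j) = decreasing⇒stepDown d j

stepDown⇒decreasing : ∀ xs → StepDown xs → Decreasing xs
stepDown⇒decreasing []           _  = []
stepDown⇒decreasing (x ∷ [])     _  = [-]
stepDown⇒decreasing (x ∷ y ∷ ys) st = st 0 ∷ stepDown⇒decreasing (y ∷ ys) (λ j → st (suc j))

get-antitone : ∀ xs → StepDown xs → ∀ {i j} → i ≤ j → get xs j ≤ get xs i
get-antitone xs st i≤j = go (≤⇒≤′ i≤j)
  where
    go : ∀ {i j} → i ≤′ j → get xs j ≤ get xs i
    go ≤′-refl      = ≤-refl
    go (≤′-step p) = ≤-trans (st _) (go p)

tail-decreasing : ∀ {x xs} → Decreasing (x ∷ xs) → Decreasing xs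
tail-decreasing [-]     = []
tail-decreasing (_ ∷ d) = d

-- Removing zeros from a weakly decreasing list only cuts off its zero tail,
-- so the padded entries, the sum and the order are unchanged.
get-dropZeros : ∀ {xs} → Decreasing xs → ∀ j → get (dropZeros xs) j ≡ get xs j
get-dropZeros {[]}         d j       = refl
get-dropZeros {zero ∷ xs}  d j       =
  trans (get-dropZeros (tail-decreasing d) j) (trans (zero-tail j) (sym (zero-tail′ j)))
  where
    zero-tail : ∀ j → get xs j ≡ 0
    zero-tail j = n≤0⇒n≡0 (get-antitone (zero ∷ xs) (decreasing⇒stepDown d) {0} {suc j} z≤n)
    zero-tail′ : ∀ j → get (zero ∷ xs) j ≡ 0
    zero-tail′ zero    = refl
    zero-tail′ (suc j) = zero-tail j
get-dropZeros {suc x ∷ xs} d zero    = refl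
get-dropZeros {suc x ∷ xs} d (suc j) = get-dropZeros (tail-decreasing d) j

sum-dropZeros : ∀ xs → sum (dropZeros xs) ≡ sum xs
sum-dropZeros []           = refl
sum-dropZeros (zero ∷ xs)  = sum-dropZeros xs
sum-dropZeros (suc x ∷ xs) = cong (suc x +_) (sum-dropZeros xs)

dropZeros-positive : ∀ xs → All (0 <_) (dropZeros xs)
dropZeros-positive []           = []
dropZeros-positive (zero ∷ xs)  = dropZeros-positive xs
dropZeros-positive (suc x ∷ xs) = s≤s z≤n ∷ dropZeros-positive xs

dropZeros-entries : ∀ {xs ys} → Decreasing xs → Decreasing ys →
                    dropZeros xs ≡ dropZeros ys → ∀ j → get xs j ≡ get ys j
dropZeros-entries {xs} {ys} dx dy e j = begin
  get xs j               ≡⟨ sym (get-dropZeros dx j) ⟩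
  get (dropZeros xs) j   ≡⟨ cong (λ zs → get zs j) e ⟩
  get (dropZeros ys) j   ≡⟨ get-dropZeros dy j ⟩
  get ys j ∎
  where open ≡-Reasoning

dropZeros-isPartition : ∀ {xs} → Decreasing xs → IsPartition (dropZeros xs)
dropZeros-isPartition {xs} d = record
  { decreasing = stepDown⇒decreasing (dropZeros xs) λ j →
      subst₂ _≤_ (sym (get-dropZeros d (suc j))) (sym (get-dropZeros d j))
             (decreasing⇒stepDown d j)
  ; positive = dropZeros-positive xs }

-- Conjugate: for a weakly decreasing list, λ'_c > j exactly when λ_{j+1} ≥ c
-- (the direction ⇐ needs c ≥ 1, since λ'_0 counts no padding zeros).
conj-≤-get : ∀ {l} → Decreasing l → ∀ c j → j < conj l c → c ≤ get l j
conj-≤-get {[]}     d c j ()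
conj-≤-get {x ∷ xs} d c j h with c ≤? x
conj-≤-get {x ∷ xs} d c zero    h       | yes c≤x = c≤x
conj-≤-get {x ∷ xs} d c (suc j) (s≤s h) | yes _   = conj-≤-get (tail-decreasing d) c j h
conj-≤-get {x ∷ xs} d c j       h       | no  c≰x =
  ⊥-elim (c≰x (≤-trans (conj-≤-get (tail-decreasing d) c 0 (≤-trans (s≤s z≤n) h))
                       (decreasing⇒stepDown d 0)))

get-≤-conj : ∀ {l} → Decreasing l → ∀ c j → 1 ≤ c → c ≤ get l j → j < conj l c
get-≤-conj {[]}     d (suc c) j _  ()
get-≤-conj {x ∷ xs} d c j c≥1 h with c ≤? x
get-≤-conj {x ∷ xs} d c zero    _   h | yes _   = s≤s z≤n
get-≤-conj {x ∷ xs} d c (suc j) c≥1 h | yes _   = s≤s (get-≤-conj (tail-decreasing d) c j c≥1 h)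
get-≤-conj {x ∷ xs} d c j       _   h | no  c≰x =
  ⊥-elim (c≰x (≤-trans h (get-antitone (x ∷ xs) (decreasing⇒stepDown d) {0} {j} z≤n)))

conj-antitone : ∀ l {c c′} → c ≤ c′ → conj l c′ ≤ conj l c
conj-antitone []       _ = z≤n
conj-antitone (x ∷ xs) {c} {c′} le with c′ ≤? x | c ≤? x
... | yes _ | yes _  = s≤s (conj-antitone xs le)
... | yes p | no ¬q  = ⊥-elim (¬q (≤-trans le p))
... | no _  | yes _  = m≤n⇒m≤1+n (conj-antitone xs le)
... | no _  | no _   = conj-antitone xs le

durfee-diagonal : ∀ i l d → durfeeFrom i l ≡ suc d → i + d ≤ get l d
durfee-diagonal i []       d ()
durfee-diagonal i (x ∷ xs) d eq with i ≤? x
durfee-diagonal i (x ∷ xs) zero    eq | yes i≤x = subst (_≤ x) (sym (+-identityʳ i)) i≤x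
durfee-diagonal i (x ∷ xs) (suc d) eq | yes _   =
  subst (_≤ get xs d) (sym (+-suc i d)) (durfee-diagonal (suc i) xs d (suc-injective eq))
durfee-diagonal i (x ∷ xs) d       () | no _

-- Within the Durfee square, s ≤ λ'_s; so g = λ'_s - s + 1 indexes one of the
-- first λ'_s parts.
durfee⇒s≤conj : ∀ {l s} → Decreasing l → 1 ≤ s → s ≤ durfee l → s ≤ conj l s
durfee⇒s≤conj {l} {suc s} d _ s≤D with durfee l in eq
... | zero   = ⊥-elim (<⇒≱ s≤D z≤n)
... | suc D′ = get-≤-conj d (suc s) s (s≤s z≤n)
                 (≤-trans s≤D (≤-trans (durfee-diagonal 1 l D′ eq)
                    (get-antitone l (decreasing⇒stepDown d) (≤-pred s≤D))))

lower : ℕ → ℕ → List ℕ → List ℕ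
lower L k l = map (_∸ L) (take k l) ++ drop k l

get-lower-< : ∀ L k l {j} → j < k → get (lower L k l) j ≡ get l j ∸ L
get-lower-< L (suc k) []       _       = sym (0∸n≡0 L)
get-lower-< L (suc k) (x ∷ xs) {zero}  _       = refl
get-lower-< L (suc k) (x ∷ xs) {suc j} (s≤s h) = get-lower-< L k xs h

get-lower-≥ : ∀ L k l {j} → k ≤ j → get (lower L k l) j ≡ get l j
get-lower-≥ L zero    l        _       = refl
get-lower-≥ L (suc k) []       _       = refl
get-lower-≥ L (suc k) (x ∷ xs) (s≤s h) = get-lower-≥ L k xs h

sum-lower : ∀ L k l → (∀ {j} → j < k → L ≤ get l j) → sum (lower L k l) + k * L ≡ sum l
sum-lower L zero    l        _     = +-identityʳ (sum l)
sum-lower L (suc k) []       big   rewrite n≤0⇒n≡0 (big {0} (s≤s z≤n)) = *-zeroʳ (suc k)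
sum-lower L (suc k) (x ∷ xs) big   = begin
  (x ∸ L + sum (lower L k xs)) + (L + k * L) ≡⟨ interchange (x ∸ L) _ L (k * L) ⟩
  (x ∸ L + L) + (sum (lower L k xs) + k * L) ≡⟨ cong₂ _+_ (m∸n+n≡m (big {0} (s≤s z≤n)))
                                                         (sum-lower L k xs (λ h → big (s≤s h))) ⟩
  x + sum xs ∎
  where open ≡-Reasoning

lower-stepDown : ∀ {L k l} → StepDown l →
                 (∀ {i j} → i < k → k ≤ j → get l j + L ≤ get l i) → StepDown (lower L k l)
lower-stepDown {L} {k} {l} st gap j with suc j <? k | j <? k
... | yes j+1<k | _ rewrite get-lower-< L k l j+1<k | get-lower-< L k l (<-trans (n<1+n j) j+1<k)
  = ∸-monoˡ-≤ L (st j)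
... | no j+1≮k | yes j<k rewrite get-lower-≥ L k l (≮⇒≥ j+1≮k) | get-lower-< L k l j<k
  = m+n≤o⇒m≤o∸n _ (gap j<k (≮⇒≥ j+1≮k))
... | no j+1≮k | no j≮k rewrite get-lower-≥ L k l (≮⇒≥ j+1≮k) | get-lower-≥ L k l (≮⇒≥ j≮k)
  = st j

lower-injective : ∀ {L k l₁ l₂} → (∀ {j} → j < k → L ≤ get l₁ j) → (∀ {j} → j < k → L ≤ get l₂ j) →
                  (∀ j → get (lower L k l₁) j ≡ get (lower L k l₂) j) → ∀ j → get l₁ j ≡ get l₂ j
lower-injective {L} {k} {l₁} {l₂} big₁ big₂ e j with j <? k
... | yes j<k = begin
  get l₁ j                       ≡⟨ sym (m∸n+n≡m (big₁ j<k)) ⟩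
  get l₁ j ∸ L + L               ≡⟨ cong (_+ L) (sym (get-lower-< L k l₁ j<k)) ⟩
  get (lower L k l₁) j + L       ≡⟨ cong (_+ L) (e j) ⟩
  get (lower L k l₂) j + L       ≡⟨ cong (_+ L) (get-lower-< L k l₂ j<k) ⟩
  get l₂ j ∸ L + L               ≡⟨ m∸n+n≡m (big₂ j<k) ⟩
  get l₂ j ∎
  where open ≡-Reasoning
... | no j≮k = trans (sym (get-lower-≥ L k l₁ (≮⇒≥ j≮k)))
                     (trans (e j) (get-lower-≥ L k l₂ (≮⇒≥ j≮k)))

offset-strict : ∀ M → StepDown M → ∀ {i j} → i < j → i ⊖ get M i ℤ.< j ⊖ get M j
offset-strict M st {i} {j} i<j = begin-strict
  i ⊖ get M i <⟨ ℤP.⊖-monoˡ-< (get M i) i<j ⟩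
  j ⊖ get M i ≤⟨ ℤP.⊖-monoʳ-≥-≤ j (get-antitone M st (<⇒≤ i<j)) ⟩
  j ⊖ get M j ∎
  where open ℤP.≤-Reasoning

offset-injective : ∀ M → StepDown M → ∀ {i j} → i ⊖ get M i ≡ j ⊖ get M j → i ≡ j
offset-injective M st {i} {j} e with <-cmp i j
... | tri< i<j _ _ = ⊥-elim (ℤP.<-irrefl e (offset-strict M st i<j))
... | tri≈ _ i≡j _ = i≡j
... | tri> _ _ j<i = ⊥-elim (ℤP.<-irrefl (sym e) (offset-strict M st j<i))

applyUpTo-const : ∀ (f : ℕ → ℕ) n {c} → (∀ {i} → i < n → f i ≡ c) → applyUpTo f n ≡ replicate n c
applyUpTo-const f zero    _ = refl
applyUpTo-const f (suc n) h = cong₂ _∷_ (h (s≤s z≤n)) (applyUpTo-const (λ i → f (suc i)) n (λ p → h (s≤s p)))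

sum-replicate : ∀ n c → sum (replicate n c) ≡ n * c
sum-replicate zero    c = refl
sum-replicate (suc n) c = cong (c +_) (sum-replicate n c)

replicate-decreasing : ∀ n c → Decreasing (replicate n c)
replicate-decreasing zero          c = []
replicate-decreasing (suc zero)    c = [-]
replicate-decreasing (suc (suc n)) c = ≤-refl ∷ replicate-decreasing (suc n) c

replicate-allEqual : ∀ n c → AllEqual (replicate n c)
replicate-allEqual n c x∈ y∈ = trans (All.lookup all-c x∈) (sym (All.lookup all-c y∈))
  where
    all-c : All (_≡ c) (replicate n c)
    all-c = replicate⁺ n refl

replicate-injective : ∀ {m n} {a b : ℕ} → replicate (suc m) a ≡ replicate (suc n) b → (m ≡ n) × (a ≡ b)
replicate-injective {m} {n} e =
  suc-injective (trans (sym (length-replicate (suc m))) (trans (cong length e) (length-replicate (suc n))))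
  , ∷-injectiveˡ e

-- The spt-crank g - λ_g + t - s, written with g = j + 1, λ_g = a + L,
-- L = d + 1 and t = d + s, simplifies to j - a.
crank-arith : ∀ j a d s →
  ((ℤ.+ (j + 1) ℤ.- ℤ.+ (a + suc d)) ℤ.+ ℤ.+ (d + s)) ℤ.- ℤ.+ s ≡ j ⊖ a
crank-arith j a d s
  rewrite ℤP.pos-+ j 1 | ℤP.pos-+ a (suc d) | ℤP.pos-+ 1 d | ℤP.pos-+ d s
  = trans (ring (ℤ.+ j) (ℤ.+ a) (ℤ.+ d) (ℤ.+ s)) (ℤP.[+m]-[+n]≡m⊖n j a)
  where
    ring : ∀ J A D S → ((J ℤ.+ ℤ.+ 1 ℤ.- (A ℤ.+ (ℤ.+ 1 ℤ.+ D))) ℤ.+ (D ℤ.+ S)) ℤ.- S ≡ J ℤ.- A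
    ring = solve-∀

module DoublyMarked {n l s t} (dmp : IsDMP n l s t) where
  open IsDMP dmp public

  k L j₀ : ℕ
  k  = conj l s
  L  = suc (t ∸ s)
  j₀ = k ∸ s

  M : List ℕ
  M = lower L k l

  dec : Decreasing l
  dec = IsPartition.decreasing isPart

  s≤k : s ≤ k
  s≤k = durfee⇒s≤conj dec s-pos s≤D

  j₀<k : j₀ < k
  j₀<k = ∸-monoʳ-< {k} {s} {0} s-pos s≤k

  L≤t : L ≤ t
  L≤t = ∸-monoʳ-< {t} {s} {0} s-pos s≤t

  -- since λ'_s = λ'_t: the first k parts are ≥ t, the remaining ones < s
  prefix-≥t : ∀ {j} → j < k → t ≤ get l j
  prefix-≥t {j} j<k = conj-≤-get dec t j (subst (j <_) conj-eq j<k)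

  prefix-≥L : ∀ {j} → j < k → L ≤ get l j
  prefix-≥L j<k = ≤-trans L≤t (prefix-≥t j<k)

  suffix-<s : ∀ {j} → k ≤ j → get l j < s
  suffix-<s {j} k≤j with s ≤? get l j
  ... | yes s≤λ = ⊥-elim (<⇒≱ (get-≤-conj dec s j s-pos s≤λ) k≤j)
  ... | no  s≰λ = ≰⇒> s≰λ

  stepDown-M : StepDown M
  stepDown-M = lower-stepDown (decreasing⇒stepDown dec) λ {i} {j} i<k k≤j → begin
    get l j + suc (t ∸ s)   ≡⟨ +-suc (get l j) (t ∸ s) ⟩
    suc (get l j) + (t ∸ s) ≤⟨ +-monoˡ-≤ (t ∸ s) (suffix-<s k≤j) ⟩
    s + (t ∸ s)             ≡⟨ m+[n∸m]≡n s≤t ⟩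
    t                       ≤⟨ prefix-≥t i<k ⟩
    get l i ∎
    where open ≤-Reasoning

  dec-M : Decreasing M
  dec-M = stepDown⇒decreasing M stepDown-M

  ψ-shape : ψ l s t ≡ (dropZeros M , replicate L k)
  ψ-shape = cong₂ _,_ α-lower β-rectangle
    where
      α-lower : proj₁ (ψ l s t) ≡ dropZeros M
      α-lower = cong (λ xs → dropZeros (xs ++ drop k l)) (map-cong shift (take k l))
        where
          t+1≡s+L : suc t ≡ s + L
          t+1≡s+L = trans (cong suc (sym (m+[n∸m]≡n s≤t))) (sym (+-suc s (t ∸ s)))
          shift : ∀ x → (x + s) ∸ (t + 1) ≡ x ∸ L
          shift x = begin
            (x + s) ∸ (t + 1)   ≡⟨ cong₂ _∸_ (+-comm x s) (+-comm t 1) ⟩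
            (s + x) ∸ suc t     ≡⟨ cong ((s + x) ∸_) t+1≡s+L ⟩
            (s + x) ∸ (s + L)   ≡⟨ [m+n]∸[m+o]≡n∸o s x L ⟩
            x ∸ L ∎
            where open ≡-Reasoning

      β-rectangle : proj₂ (ψ l s t) ≡ replicate L k
      β-rectangle = trans (map-upTo (λ i → conj l (s + i)) L) (applyUpTo-const (λ i → conj l (s + i)) L column)
        where
          -- λ'_{s+i} is squeezed between λ'_t = λ'_s and λ'_s for s + i ≤ t
          column : ∀ {i} → i < L → conj l (s + i) ≡ k
          column (s≤s i≤t∸s) = ≤-antisym (conj-antitone l (m≤m+n s _))
            (≤-trans (≤-reflexive conj-eq)
                     (conj-antitone l (≤-trans (+-monoʳ-≤ s i≤t∸s) (≤-reflexive (m+[n∸m]≡n s≤t)))))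

  crank-offset : sptCrank l s t ≡ j₀ ⊖ get M j₀
  crank-offset = begin
    sptCrank l s t
      ≡⟨ cong₂ (λ p u → ((ℤ.+ (j₀ + 1) ℤ.- ℤ.+ p) ℤ.+ ℤ.+ u) ℤ.- ℤ.+ s) λ-g (sym (m∸n+n≡m s≤t)) ⟩
    ((ℤ.+ (j₀ + 1) ℤ.- ℤ.+ (get M j₀ + L)) ℤ.+ ℤ.+ (t ∸ s + s)) ℤ.- ℤ.+ s
      ≡⟨ crank-arith j₀ (get M j₀) (t ∸ s) s ⟩
    j₀ ⊖ get M j₀ ∎
    where
      open ≡-Reasoning
      λ-g : part l (j₀ + 1) ≡ get M j₀ + L
      λ-g = begin
        part l (j₀ + 1)     ≡⟨ cong (part l) (+-comm j₀ 1) ⟩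
        part l (suc j₀)     ≡⟨ part-get l j₀ ⟩
        get l j₀            ≡⟨ sym (m∸n+n≡m (prefix-≥L j₀<k)) ⟩
        get l j₀ ∸ L + L    ≡⟨ cong (_+ L) (sym (get-lower-< L k l j₀<k)) ⟩
        get M j₀ + L ∎

ψ-in-P : ∀ {m n l s t} → InQ m n l s t → InP n (ψ l s t)
ψ-in-P {n = n} {l} {s} {t} (dmp , _) =
  subst (InP n) (sym ψ-shape)
    (dropZeros-isPartition dec-M , β-isPartition , size-ok , replicate-allEqual L k)
  where
    open DoublyMarked dmp
    β-isPartition : IsPartition (replicate L k)
    β-isPartition = record
      { decreasing = replicate-decreasing L k
      ; positive   = replicate⁺ L (≤-trans s-pos s≤k) }
    size-ok : sum (dropZeros M) + sum (replicate L k) ≡ n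
    size-ok = begin
      sum (dropZeros M) + sum (replicate L k) ≡⟨ cong₂ _+_ (sum-dropZeros M) (sum-replicate L k) ⟩
      sum M + L * k                           ≡⟨ cong (sum M +_) (*-comm L k) ⟩
      sum M + k * L                           ≡⟨ sum-lower L k l prefix-≥L ⟩
      sum l                                   ≡⟨ size ⟩
      n ∎
      where open ≡-Reasoning

ψ-injective : ∀ {m n l₁ s₁ t₁ l₂ s₂ t₂} → InQ m n l₁ s₁ t₁ → InQ m n l₂ s₂ t₂ →
              ψ l₁ s₁ t₁ ≡ ψ l₂ s₂ t₂ → (l₁ ≡ l₂) × (s₁ ≡ s₂) × (t₁ ≡ t₂)
ψ-injective {l₁ = l₁} {s₁} {t₁} {l₂} {s₂} {t₂} (d₁ , c₁) (d₂ , c₂) eq = l-eq , s-eq , t-eq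
  where
    module Q₁ = DoublyMarked d₁
    module Q₂ = DoublyMarked d₂
    shape-eq : (dropZeros Q₁.M , replicate Q₁.L Q₁.k) ≡ (dropZeros Q₂.M , replicate Q₂.L Q₂.k)
    shape-eq = trans (sym Q₁.ψ-shape) (trans eq Q₂.ψ-shape)
    Lk-eq : (t₁ ∸ s₁ ≡ t₂ ∸ s₂) × (Q₁.k ≡ Q₂.k)
    Lk-eq = replicate-injective (cong proj₂ shape-eq)
    L-eq : Q₁.L ≡ Q₂.L
    L-eq = cong suc (proj₁ Lk-eq)
    k-eq : Q₁.k ≡ Q₂.k
    k-eq = proj₂ Lk-eq
    M-eq : ∀ j → get Q₁.M j ≡ get Q₂.M j
    M-eq = dropZeros-entries Q₁.dec-M Q₂.dec-M (cong proj₁ shape-eq)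
    j₀-eq : Q₁.j₀ ≡ Q₂.j₀
    j₀-eq = offset-injective Q₁.M Q₁.stepDown-M
      (trans (sym Q₁.crank-offset) (trans c₁ (trans (sym c₂) (trans Q₂.crank-offset
        (cong (Q₂.j₀ ⊖_) (sym (M-eq Q₂.j₀)))))))
    s-eq : s₁ ≡ s₂
    s-eq = trans (sym (m∸[m∸n]≡n Q₁.s≤k)) (trans (cong₂ _∸_ k-eq j₀-eq) (m∸[m∸n]≡n Q₂.s≤k))
    t-eq : t₁ ≡ t₂
    t-eq = trans (sym (m∸n+n≡m Q₁.s≤t)) (trans (cong₂ _+_ (proj₁ Lk-eq) s-eq) (m∸n+n≡m Q₂.s≤t))
    prefix₂-≥L : ∀ {j} → j < Q₁.k → Q₁.L ≤ get l₂ j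
    prefix₂-≥L {j} j<k = subst (_≤ get l₂ j) (sym L-eq) (Q₂.prefix-≥L (subst (j <_) k-eq j<k))
    lowered-eq : ∀ j → get (lower Q₁.L Q₁.k l₁) j ≡ get (lower Q₁.L Q₁.k l₂) j
    lowered-eq j = trans (M-eq j) (cong₂ (λ L k → get (lower L k l₂) j) (sym L-eq) (sym k-eq))
    l-eq : l₁ ≡ l₂
    l-eq = positive-ext (IsPartition.positive Q₁.isPart) (IsPartition.positive Q₂.isPart)
      (lower-injective Q₁.prefix-≥L prefix₂-≥L lowered-eq)

lemma2p5 : (m : ℤ) (n : ℕ) → 1 ≤ n →
    ((l : List ℕ) (s t : ℕ) → InQ m n l s t → InP n (ψ l s t))
    × ((l₁ : List ℕ) (s₁ t₁ : ℕ) (l₂ : List ℕ) (s₂ t₂ : ℕ) →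
    InQ m n l₁ s₁ t₁ → InQ m n l₂ s₂ t₂ →
    ψ l₁ s₁ t₁ ≡ ψ l₂ s₂ t₂ → (l₁ ≡ l₂) × (s₁ ≡ s₂) × (t₁ ≡ t₂))
lemma2p5 m n _ = (λ l s t → ψ-in-P) , (λ l₁ s₁ t₁ l₂ s₂ t₂ → ψ-injective)
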